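{- Let $R$ be an extended regular expression, $Q$ a string of length $n$, and let $C$ be an internal cluster of the cluster partition of $T(R)$ with more than one node, with root node $v$ and unique extended node $p$. Let $A_C$ be the TNFA of $C$ with start state $\theta$, accept state $\phi$, extended start state $\theta'$ and extended end state $\phi'$, and let $G(p)$ be the match graph of $R(p)$. Then \[ G \;=\; G_{\theta,\phi}\;\Big|\;\Big(G_{\theta,\theta'} \odot G(p) \odot \big(G_{\phi',\theta'}\odot G(p)\big)^* \odot G_{\phi',\phi}\Big) \] equals the match graph $G(v)$ of $R(v)$, where $G_{x,y}=G(A_C,x,y)$.
   Context: Extended regular expressions use concatenation $\odot$, union $\mid$, intersection $\cap$, complement $\neg$, star $^*$ over alphabet $\Sigma$; $\cap$ and $\neg$ are extended operators. $T(R)$ is the parse tree and $R(u)$ the subexpression rooted at node $u$. Extended nodes: nodes labeled by an extended operator or that are the lowest common ancestor of two such nodes. Deleting the edges from each extended node to its children partitions $T(R)$ into clusters; contracting the remaining edges gives the macro tree; an internal cluster is a non-leaf of the macro tree, and it contains exactly one extended node $p$ (all its other nodes are non-extended). For such $C$, $A_C$ is the Thompson NFA (standard recursive construction with $\epsilon$-transitions; start $\theta$, accept $\phi$) of the regular expression given by the nodes of $C$, in which $p$ is treated as a leaf labeled by a fresh symbol $\beta\notin\Sigma$; the $\beta$-transition goes from $\theta'$ to $\phi'$. Paths match strings when their labels concatenate (ignoring $\epsilon$) to the string. For $Q$ of length $n$: the match graph of a subexpression $R(u)$ is the directed graph on $g_1,\dots,g_{n+1}$ with edge $(g_i,g_j)$,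 $i\le j$, iff $Q[i,j-1]\in L(R(u))$ ($Q[i,i-1]$ empty); $G(A,s,t)$ has edge $(g_i,g_j)$ iff some path from $s$ to $t$ in $A$ matches $Q[i,j-1]$ (self-loops at all vertices if $s=t$). Operations on match graphs: $G\odot F$ has edge $(g_i,g_j)$ iff $\exists l$ with $(g_i,g_l)\in G$, $(g_l,g_j)\in F$; $G\mid F$ is edgewise union; $G^*$ is the transitive closure of $G$ with a self-loop added at every vertex. -}

module Defs where

open import Data.Nat using (ℕ; zero; suc; _∸_; _≤_)
open import Data.Fin using (Fin; toℕ)
open import Data.List using (List; []; _∷_; _++_; [_]; take; drop; length)
open import Data.List.Membership.Propositional using (_∈_)
open import Data.Product using (Σ; ∃; ∃₂; _×_; _,_)
open import Data.Sum using (_⊎_)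
open import Data.Maybe using (Maybe; just; nothing)
open import Data.Empty using (⊥)
open import Data.Unit using (⊤)
open import Relation.Nullary using (¬_)
open import Relation.Binary.PropositionalEquality using (_≡_; _≢_)
import Relation.Binary.Construct.Closure.ReflexiveTransitive as RT

data ERE (A : Set) : Set where
  chr  : A → ERE A
  eps  : ERE A
  _·_  : ERE A → ERE A → ERE A
  _∣_  : ERE A → ERE A → ERE A
  _∩_  : ERE A → ERE A → ERE A
  ∁    : ERE A → ERE A
  _⋆   : ERE A → ERE A

data StarL {A : Set} (P : List A → Set) : List A → Set where
  nil  : StarL P []
  cons : ∀ {u w} → P u → StarL P w → StarL P (u ++ w)

_∈L_ : {A : Set} → List A → ERE A → Set
w ∈L chr a   = w ≡ [ a ]
w ∈L eps     = w ≡ []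
w ∈L (S · T) = ∃₂ λ u v → (w ≡ u ++ v) × (u ∈L S) × (v ∈L T)
w ∈L (S ∣ T) = (w ∈L S) ⊎ (w ∈L T)
w ∈L (S ∩ T) = (w ∈L S) × (w ∈L T)
w ∈L ∁ S     = ¬ (w ∈L S)
w ∈L (S ⋆)   = StarL (λ u → u ∈L S) w

-- Nodes of the parse tree T(R): positions = paths from the root

data Dir : Set where
  left right : Dir          -- the only child of a unary node is 'left'

Pos : Set
Pos = List Dir

subAt : {A : Set} → ERE A → Pos → Maybe (ERE A)
subAt e [] = just e
subAt (S · T) (left ∷ u)  = subAt S u
subAt (S · T) (right ∷ u) = subAt T u
subAt (S ∣ T) (left ∷ u)  = subAt S u
subAt (S ∣ T) (right ∷ u) = subAt T u
subAt (S ∩ T) (left ∷ u)  = subAt S u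
subAt (S ∩ T) (right ∷ u) = subAt T u
subAt (∁ S) (left ∷ u)    = subAt S u
subAt (S ⋆) (left ∷ u)    = subAt S u
subAt _ (_ ∷ _) = nothing

Node : {A : Set} → ERE A → Pos → Set
Node R u = ∃ λ e → subAt R u ≡ just e

_≼_ : Pos → Pos → Set
u ≼ w = ∃ λ d → u ++ d ≡ w

_≺_ : Pos → Pos → Set
u ≺ w = ∃ λ x → ∃ λ d → u ++ (x ∷ d) ≡ w

lca : Pos → Pos → Pos
lca (left ∷ u)  (left ∷ w)  = left ∷ lca u w
lca (right ∷ u) (right ∷ w) = right ∷ lca u w
lca _ _ = []

IsExtOp : {A : Set} → ERE A → Set
IsExtOp (_ ∩ _) = ⊤
IsExtOp (∁ _)   = ⊤
IsExtOp _       = ⊥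

ExtOpNode : {A : Set} → ERE A → Pos → Set
ExtOpNode R u = ∃ λ e → (subAt R u ≡ just e) × IsExtOp e

ExtNode : {A : Set} → ERE A → Pos → Set
ExtNode R u = ExtOpNode R u ⊎ (∃₂ λ a b → ExtOpNode R a × ExtOpNode R b × lca a b ≡ u)

-- Cluster partition (delete the edges from each extended node to its children)

ClusterRoot : {A : Set} → ERE A → Pos → Set
ClusterRoot R v = Node R v × ((v ≡ []) ⊎ (∃₂ λ w d → (v ≡ w ++ [ d ]) × ExtNode R w))

InCluster : {A : Set} → ERE A → Pos → Pos → Set
InCluster R v u = Node R u × v ≼ u × (∀ w → v ≼ w → w ≺ u → ¬ ExtNode R w)

-- internal cluster = non-leaf of the macro tree: some node of the cluster is
-- extended and has a child in T(R)
Internal : {A : Set} → ERE A → Pos → Set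
Internal R v = ∃ λ u → InCluster R v u × ExtNode R u × (∃ λ d → Node R (u ++ [ d ]))

MoreThanOneNode : {A : Set} → ERE A → Pos → Set
MoreThanOneNode R v = ∃ λ u → InCluster R v u × (u ≢ v)

data Sym (A : Set) : Set where
  sym : A → Sym A
  β   : Sym A

data RE (B : Set) : Set where
  chr  : B → RE B
  eps  : RE B
  _·_  : RE B → RE B → RE B
  _∣_  : RE B → RE B → RE B
  _⋆   : RE B → RE B

toRE : {A : Set} → ERE A → Maybe (RE (Sym A))
toRE (chr a) = just (chr (sym a))
toRE eps = just eps
toRE (S · T) with toRE S | toRE T
... | just s | just t = just (s · t)
... | _ | _ = nothing
toRE (S ∣ T) with toRE S | toRE T
... | just s | just t = just (s ∣ t)
... | _ | _ = nothing
toRE (S ∩ T) = nothing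
toRE (∁ S) = nothing
toRE (S ⋆) with toRE S
... | just s = just (s ⋆)
... | nothing = nothing

-- The expression given by the nodes of the subtree of R(v) where the node at
-- relative position p is replaced by a leaf β (nothing if some other node is
-- labeled by an extended operator, or p is not a node).
hole : {A : Set} → ERE A → Pos → Maybe (RE (Sym A))
hole e [] = just (chr β)
hole (S · T) (left ∷ p) with hole S p | toRE T
... | just s | just t = just (s · t)
... | _ | _ = nothing
hole (S · T) (right ∷ p) with toRE S | hole T p
... | just s | just t = just (s · t)
... | _ | _ = nothing
hole (S ∣ T) (left ∷ p) with hole S p | toRE T
... | just s | just t = just (s ∣ t)
... | _ | _ = nothing
hole (S ∣ T) (right ∷ p) with toRE S | hole T p
... | just s | just t = just (s ∣ t)
... | _ | _ = nothing
hole (S ⋆) (left ∷ p) with hole S p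
... | just s = just (s ⋆)
... | nothing = nothing
hole _ (_ ∷ _) = nothing

-- Thompson NFA (states are natural numbers; ε-transitions labeled nothing)

record NFA (B : Set) : Set where
  constructor mkNFA
  field
    start  : ℕ
    accept : ℕ
    trans  : List (ℕ × Maybe B × ℕ)
open NFA public

record Built (B : Set) : Set where
  constructor built
  field
    acc   : ℕ
    fresh : ℕ
    edges : List (ℕ × Maybe B × ℕ)

-- build e s k : Thompson automaton for e with (already allocated) start state s,
-- using fresh states k, k+1, ...  Concatenation identifies the accept state of
-- the left part with the start state of the right part.
build : {B : Set} → RE B → ℕ → ℕ → Built B
build (chr a) s k = built k (suc k) ((s , just a , k) ∷ [])
build eps s k = built k (suc k) ((s , nothing , k) ∷ [])
build (S · T) s k with build S s k
... | built a₁ k₁ t₁ with build T a₁ k₁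
...   | built a₂ k₂ t₂ = built a₂ k₂ (t₁ ++ t₂)
build (S ∣ T) s k with build S k (suc k)
... | built a₁ k₁ t₁ with build T k₁ (suc k₁)
...   | built a₂ k₂ t₂ =
  built k₂ (suc k₂)
    ((s , nothing , k) ∷ (s , nothing , k₁) ∷ (a₁ , nothing , k₂) ∷ (a₂ , nothing , k₂) ∷ (t₁ ++ t₂))
build (S ⋆) s k with build S k (suc k)
... | built a₁ k₁ t₁ =
  built k₁ (suc k₁)
    ((s , nothing , k) ∷ (s , nothing , k₁) ∷ (a₁ , nothing , k) ∷ (a₁ , nothing , k₁) ∷ t₁)

thompson : {B : Set} → RE B → NFA B
thompson e with build e 0 1
... | built a _ t = mkNFA 0 a t

data Run {A : Set} (M : NFA (Sym A)) : ℕ → List A → ℕ → Set where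
  here  : ∀ {s} → Run M s [] s
  εstep : ∀ {s s' w t} → (s , nothing , s') ∈ trans M → Run M s' w t → Run M s w t
  cstep : ∀ {s s' a w t} → (s , just (sym a) , s') ∈ trans M → Run M s' w t → Run M s (a ∷ w) t

-- Match graphs on g₁ … g_{n+1}; vertex i : Fin (suc n) stands for g_{i+1}

Graph : ℕ → Set₁
Graph n = Fin (suc n) → Fin (suc n) → Set

-- Q[i+1 , j]  (1-based), i.e. the characters of Q at 0-based positions i … j-1
slice : {A : Set} → List A → ℕ → ℕ → List A
slice Q i j = take (j ∸ i) (drop i Q)

MG : {A : Set} (Q : List A) → ERE A → Graph (length Q)
MG Q e i j = (toℕ i ≤ toℕ j) × (slice Q (toℕ i) (toℕ j) ∈L e)

NG : {A : Set} (Q : List A) → NFA (Sym A) → ℕ → ℕ → Graph (length Q)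
NG Q M s t i j = (toℕ i ≤ toℕ j) × Run M s (slice Q (toℕ i) (toℕ j)) t

infixr 7 _⊙_
infixr 6 _∣G_

_⊙_ : {n : ℕ} → Graph n → Graph n → Graph n
(G ⊙ F) i j = ∃ λ l → G i l × F l j

_∣G_ : {n : ℕ} → Graph n → Graph n → Graph n
(G ∣G F) i j = G i j ⊎ F i j

_* : {n : ℕ} → Graph n → Graph n
(G *) = RT.Star G

_≐_ : {n : ℕ} → Graph n → Graph n → Set
G ≐ F = ∀ i j → (G i j → F i j) × (F i j → G i j)

-- Read the β-leaf of the cluster expression E as the language of R(p); then E denotes exactly
-- L(R(v)), and the Thompson automaton of E, with its β-edge θ′ → φ′ allowed to read any word
-- of L(R(p)), accepts exactly that language. Such a walk either never uses the β-edge (the first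
-- term) or is cut at its uses into a path θ → θ′, a word of R(p), repeated blocks (path φ′ → θ′,
-- word of R(p)), and a final path φ′ → φ, which is the second term. Soundness of Thompson's
-- construction is proved for a sub-automaton embedded in an arbitrary larger one, by induction
-- on the expression: the states of each sub-automaton form an interval, and the surrounding
-- automaton adds edges only out of its accept state.
module Submission where

open import Defs
open import Data.Nat using (ℕ; zero; suc; _+_; _∸_; _≤_; _<_; _⊓_; s≤s; z<s)
open import Data.Nat.Induction using (<-wellFounded)
open import Induction.WellFounded using (Acc)
open import Data.Nat.Properties
open import Data.Fin using (Fin; toℕ; fromℕ<)
open import Data.Fin.Properties using (toℕ≤pred[n]; toℕ-fromℕ<)
open import Data.List using (List; []; _∷_; _++_; [_]; take; drop; length)
open import Data.List.Properties
  using (++-assoc; ++-identityʳ; ∷-injective; length-take; length-drop; drop-drop; take-[]; length-++)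
open import Data.List.Membership.Propositional using (_∈_)
open import Data.List.Membership.Propositional.Properties using (∈-++⁺ˡ; ∈-++⁺ʳ; ∈-++⁻)
open import Data.List.Relation.Unary.Any using (here; there)
open import Data.Product using (Σ; ∃; ∃₂; _×_; _,_; proj₁; proj₂)
open import Data.Sum using (_⊎_; inj₁; inj₂; [_,_]′)
import Data.Sum as Sum
open import Data.Maybe using (Maybe; just; nothing)
open import Data.Empty using (⊥; ⊥-elim)
open import Data.Unit using (⊤; tt)
open import Function using (id; _∘_)
open import Relation.Nullary using (¬_)
open import Relation.Unary using (_⊆_; _∪_) renaming (_≐_ to _≋_)
open import Relation.Binary.PropositionalEquality
  using (_≡_; _≢_; refl; cong; cong₂; subst; module ≡-Reasoning)
  renaming (sym to ≡-sym; trans to ≡-trans)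
open import Relation.Binary.Construct.Closure.ReflexiveTransitive using (ε; _◅_)

open Built

private
  variable
    A B : Set
    P P′ Q Q′ : List A → Set
    s s′ k k′ k″ k‴ x y z : ℕ

Lang : ERE A → List A → Set
Lang e w = w ∈L e

_⊙ᴸ_ : (List A → Set) → (List A → Set) → List A → Set
(P ⊙ᴸ Q) w = ∃₂ λ u v → (w ≡ u ++ v) × P u × Q v

⊙ᴸ-mono : P ⊆ P′ → Q ⊆ Q′ → (P ⊙ᴸ Q) ⊆ (P′ ⊙ᴸ Q′)
⊙ᴸ-mono f g (u , v , eq , pu , qv) = u , v , eq , f pu , g qv

⊙ᴸ-cong : P ≋ P′ → Q ≋ Q′ → (P ⊙ᴸ Q) ≋ (P′ ⊙ᴸ Q′)
⊙ᴸ-cong (f , f′) (g , g′) = ⊙ᴸ-mono f g , ⊙ᴸ-mono f′ g′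

∪-cong : P ≋ P′ → Q ≋ Q′ → (P ∪ Q) ≋ (P′ ∪ Q′)
∪-cong (f , f′) (g , g′) = Sum.map f g , Sum.map f′ g′

StarL-mono : P ⊆ P′ → StarL P ⊆ StarL P′
StarL-mono f nil         = nil
StarL-mono f (cons p ps) = cons (f p) (StarL-mono f ps)

StarL-cong : P ≋ P′ → StarL P ≋ StarL P′
StarL-cong (f , f′) = StarL-mono f , StarL-mono f′

BetaFree : RE (Sym A) → Set
BetaFree (chr (sym _)) = ⊤
BetaFree (chr β)       = ⊥
BetaFree eps           = ⊤
BetaFree (S · T)       = BetaFree S × BetaFree T
BetaFree (S ∣ T)       = BetaFree S × BetaFree T
BetaFree (S ⋆)         = BetaFree S

SingleBeta : RE (Sym A) → Set
SingleBeta (chr (sym _)) = ⊥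
SingleBeta (chr β)       = ⊤
SingleBeta eps           = ⊥
SingleBeta (S · T)       = (SingleBeta S × BetaFree T) ⊎ (BetaFree S × SingleBeta T)
SingleBeta (S ∣ T)       = (SingleBeta S × BetaFree T) ⊎ (BetaFree S × SingleBeta T)
SingleBeta (S ⋆)         = SingleBeta S

module Semantics {A : Set} (P : List A → Set) where

  Consumes : Maybe (Sym A) → List A → Set
  Consumes nothing        u = u ≡ []
  Consumes (just (sym a)) u = u ≡ [ a ]
  Consumes (just β)       u = P u

  ⟦_⟧ : RE (Sym A) → List A → Set
  ⟦ chr c ⟧ = Consumes (just c)
  ⟦ eps ⟧   = Consumes nothing
  ⟦ S · T ⟧ = ⟦ S ⟧ ⊙ᴸ ⟦ T ⟧
  ⟦ S ∣ T ⟧ = ⟦ S ⟧ ∪ ⟦ T ⟧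
  ⟦ S ⋆ ⟧   = StarL ⟦ S ⟧

  toRE-correct : (e : ERE A) {r : RE (Sym A)} → toRE e ≡ just r → BetaFree r × Lang e ≋ ⟦ r ⟧
  toRE-correct (chr a) refl = tt , id , id
  toRE-correct eps     refl = tt , id , id
  toRE-correct (S · T) eq with toRE S in eS | toRE T in eT
  toRE-correct (S · T) refl | just _ | just _ with toRE-correct S eS | toRE-correct T eT
  ... | fS , S≋ | fT , T≋ = (fS , fT) , ⊙ᴸ-cong S≋ T≋
  toRE-correct (S · T) () | just _ | nothing
  toRE-correct (S · T) () | nothing | _
  toRE-correct (S ∣ T) eq with toRE S in eS | toRE T in eT
  toRE-correct (S ∣ T) refl | just _ | just _ with toRE-correct S eS | toRE-correct T eT
  ... | fS , S≋ | fT , T≋ = (fS , fT) , ∪-cong S≋ T≋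
  toRE-correct (S ∣ T) () | just _ | nothing
  toRE-correct (S ∣ T) () | nothing | _
  toRE-correct (S ⋆) eq with toRE S in eS
  toRE-correct (S ⋆) refl | just _ with toRE-correct S eS
  ... | fS , S≋ = fS , StarL-cong S≋
  toRE-correct (S ⋆) () | nothing
  toRE-correct (S ∩ T) ()
  toRE-correct (∁ S) ()

hole-correct : (e : ERE A) (p : Pos) {E : RE (Sym A)} {Rp : ERE A} →
               hole e p ≡ just E → subAt e p ≡ just Rp →
               SingleBeta E × Lang e ≋ Semantics.⟦_⟧ (Lang Rp) E
hole-correct e [] refl refl = tt , id , id
hole-correct (S · T) (left ∷ p) eq sp with hole S p in hS | toRE T in eT
hole-correct (S · T) (left ∷ p) refl sp | just _ | just _
  with hole-correct S p hS sp | Semantics.toRE-correct _ T eT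
... | oS , S≋ | fT , T≋ = inj₁ (oS , fT) , ⊙ᴸ-cong S≋ T≋
hole-correct (S · T) (left ∷ p) () sp | just _ | nothing
hole-correct (S · T) (left ∷ p) () sp | nothing | _
hole-correct (S · T) (right ∷ p) eq sp with toRE S in eS | hole T p in hT
hole-correct (S · T) (right ∷ p) refl sp | just _ | just _
  with Semantics.toRE-correct _ S eS | hole-correct T p hT sp
... | fS , S≋ | oT , T≋ = inj₂ (fS , oT) , ⊙ᴸ-cong S≋ T≋
hole-correct (S · T) (right ∷ p) () sp | just _ | nothing
hole-correct (S · T) (right ∷ p) () sp | nothing | _
hole-correct (S ∣ T) (left ∷ p) eq sp with hole S p in hS | toRE T in eT
hole-correct (S ∣ T) (left ∷ p) refl sp | just _ | just _
  with hole-correct S p hS sp | Semantics.toRE-correct _ T eT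
... | oS , S≋ | fT , T≋ = inj₁ (oS , fT) , ∪-cong S≋ T≋
hole-correct (S ∣ T) (left ∷ p) () sp | just _ | nothing
hole-correct (S ∣ T) (left ∷ p) () sp | nothing | _
hole-correct (S ∣ T) (right ∷ p) eq sp with toRE S in eS | hole T p in hT
hole-correct (S ∣ T) (right ∷ p) refl sp | just _ | just _
  with Semantics.toRE-correct _ S eS | hole-correct T p hT sp
... | fS , S≋ | oT , T≋ = inj₂ (fS , oT) , ∪-cong S≋ T≋
hole-correct (S ∣ T) (right ∷ p) () sp | just _ | nothing
hole-correct (S ∣ T) (right ∷ p) () sp | nothing | _
hole-correct (S ⋆) (left ∷ p) eq sp with hole S p in hS
hole-correct (S ⋆) (left ∷ p) refl sp | just _ with hole-correct S p hS sp
... | oS , S≋ = oS , StarL-cong S≋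
hole-correct (S ⋆) (left ∷ p) () sp | nothing
hole-correct (S ⋆) (right ∷ p) () sp
hole-correct (chr _) (_ ∷ _) () sp
hole-correct eps (_ ∷ _) () sp
hole-correct (_ ∩ _) (_ ∷ _) () sp
hole-correct (∁ _) (_ ∷ _) () sp

subAt-++ : (R : ERE A) (v q : Pos) {Rv : ERE A} → subAt R v ≡ just Rv → subAt R (v ++ q) ≡ subAt Rv q
subAt-++ R       []          q refl = refl
subAt-++ (S · T) (left ∷ v)  q eq = subAt-++ S v q eq
subAt-++ (S · T) (right ∷ v) q eq = subAt-++ T v q eq
subAt-++ (S ∣ T) (left ∷ v)  q eq = subAt-++ S v q eq
subAt-++ (S ∣ T) (right ∷ v) q eq = subAt-++ T v q eq
subAt-++ (S ∩ T) (left ∷ v)  q eq = subAt-++ S v q eq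
subAt-++ (S ∩ T) (right ∷ v) q eq = subAt-++ T v q eq
subAt-++ (∁ S)   (left ∷ v)  q eq = subAt-++ S v q eq
subAt-++ (S ⋆)   (left ∷ v)  q eq = subAt-++ S v q eq
subAt-++ (∁ S)   (right ∷ v) q ()
subAt-++ (S ⋆)   (right ∷ v) q ()
subAt-++ (chr _) (_ ∷ _)     q ()
subAt-++ eps     (_ ∷ _)     q ()

Region : ℕ → ℕ → ℕ → ℕ → Set
Region s k k′ x = x ≡ s ⊎ (k ≤ x × x < k′)

region-< : s < k′ → Region s k k′ x → x < k′
region-< s<k′ (inj₁ refl)        = s<k′
region-< _    (inj₂ (_ , x<k′)) = x<k′

region-≥ : s ≤ k → Region s k k′ x → s ≤ x
region-≥ _   (inj₁ refl)       = ≤-refl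
region-≥ s≤k (inj₂ (k≤x , _)) = ≤-trans s≤k k≤x

¬region-below : x ≢ s → x < k → ¬ Region s k k′ x
¬region-below x≢s _   (inj₁ x≡s)       = x≢s x≡s
¬region-below _   x<k (inj₂ (k≤x , _)) = <⇒≱ x<k k≤x

region-widen : k′ ≤ k″ → Region s k k′ x → Region s k k″ x
region-widen _     (inj₁ refl)             = inj₁ refl
region-widen k′≤k″ (inj₂ (k≤x , x<k′)) = inj₂ (k≤x , <-≤-trans x<k′ k′≤k″)

region-nest : k ≤ s′ → s′ < k″ → k ≤ k′ → k‴ ≤ k″ → Region s′ k′ k‴ x → Region s k k″ x
region-nest k≤s′ s′<k″ _ _ (inj₁ refl) = inj₂ (k≤s′ , s′<k″)
region-nest _ _ k≤k′ k‴≤k″ (inj₂ (k′≤x , x<k‴)) = inj₂ (≤-trans k≤k′ k′≤x , <-≤-trans x<k‴ k‴≤k″)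

-- build e s k uses the states s, k, …, fresh − 1; only the non-accepting ones have outgoing edges.
Owned : RE B → ℕ → ℕ → ℕ → Set
Owned e s k x = Region s k (fresh (build e s k)) x × x ≢ acc (build e s k)

record WellFormed (e : RE B) (s k : ℕ) : Set where
  constructor wf
  field
    k≤acc        : k ≤ acc (build e s k)
    acc<fresh    : acc (build e s k) < fresh (build e s k)
    source-owned : ∀ {x l z} → (x , l , z) ∈ edges (build e s k) → Owned e s k x

start-owned : {e : RE B} → WellFormed e s k → s < k → Owned e s k s
start-owned w s<k = inj₁ refl , <⇒≢ (<-≤-trans s<k (WellFormed.k≤acc w))

-- build e s k sits inside build o s′ k′, which adds no edges out of its states.
record Component (e : RE B) (s k : ℕ) (o : RE B) (s′ k′ : ℕ) : Set where
  field
    owned⊆ : Owned e s k ⊆ Owned o s′ k′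
    local  : ∀ {x l z} → (x , l , z) ∈ edges (build o s′ k′) → Owned e s k x →
             (x , l , z) ∈ edges (build e s k)

module CatParts (S T : RE B) (s k : ℕ) (s<k : s < k) (wfS : WellFormed S s k)
                (wfT : WellFormed T (acc (build S s k)) (fresh (build S s k))) where
  module WS = WellFormed wfS
  module WT = WellFormed wfT

  a₁ = acc (build S s k)
  k₁ = fresh (build S s k)
  t₁ = edges (build S s k)
  a₂ = acc (build T a₁ k₁)
  k₂ = fresh (build T a₁ k₁)

  k≤k₁ : k ≤ k₁
  k≤k₁ = ≤-trans WS.k≤acc (<⇒≤ WS.acc<fresh)

  k₁<k₂ : k₁ < k₂
  k₁<k₂ = ≤-<-trans WT.k≤acc WT.acc<fresh

  s<k₁ : s < k₁
  s<k₁ = <-≤-trans s<k k≤k₁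

  S-part : Component S s k (S · T) s k
  S-part = record
    { owned⊆ = λ (r , _) → region-widen (<⇒≤ k₁<k₂) r , <⇒≢ (<-≤-trans (region-< s<k₁ r) WT.k≤acc)
    ; local  = local
    }
    where
    local : ∀ {x l z} → (x , l , z) ∈ t₁ ++ edges (build T a₁ k₁) → Owned S s k x → (x , l , z) ∈ t₁
    local m (r , x≢a₁) with ∈-++⁻ t₁ m
    ... | inj₁ m₁ = m₁
    ... | inj₂ m₂ = ⊥-elim (¬region-below x≢a₁ (region-< s<k₁ r) (proj₁ (WT.source-owned m₂)))

  T-part : Component T a₁ k₁ (S · T) s k
  T-part = record
    { owned⊆ = λ (r , x≢a₂) → region-nest WS.k≤acc (<-trans WS.acc<fresh k₁<k₂) k≤k₁ ≤-refl r , x≢a₂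
    ; local  = local
    }
    where
    local : ∀ {x l z} → (x , l , z) ∈ t₁ ++ edges (build T a₁ k₁) → Owned T a₁ k₁ x →
            (x , l , z) ∈ edges (build T a₁ k₁)
    local m (r , _) with ∈-++⁻ t₁ m
    ... | inj₂ m₂ = m₂
    ... | inj₁ m₁ with WS.source-owned m₁
    ...   | r₁ , x≢a₁ = ⊥-elim (¬region-below x≢a₁ (region-< s<k₁ r₁) r)

  wf-· : WellFormed (S · T) s k
  wf-· = wf (≤-trans k≤k₁ WT.k≤acc) WT.acc<fresh source-owned
    where
    source-owned : ∀ {x l z} → (x , l , z) ∈ t₁ ++ edges (build T a₁ k₁) → Owned (S · T) s k x
    source-owned m with ∈-++⁻ t₁ m
    ... | inj₁ m₁ = Component.owned⊆ S-part (WS.source-owned m₁)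
    ... | inj₂ m₂ = Component.owned⊆ T-part (WT.source-owned m₂)

module AltParts (S T : RE B) (s k : ℕ) (s<k : s < k) (wfS : WellFormed S k (suc k))
                (wfT : WellFormed T (fresh (build S k (suc k))) (suc (fresh (build S k (suc k))))) where
  module WS = WellFormed wfS
  module WT = WellFormed wfT

  a₁ = acc (build S k (suc k))
  k₁ = fresh (build S k (suc k))
  t₁ = edges (build S k (suc k))
  a₂ = acc (build T k₁ (suc k₁))
  k₂ = fresh (build T k₁ (suc k₁))
  t₂ = edges (build T k₁ (suc k₁))

  k<k₁ : k < k₁
  k<k₁ = <-trans WS.k≤acc WS.acc<fresh

  k₁<k₂ : k₁ < k₂
  k₁<k₂ = <-trans WT.k≤acc WT.acc<fresh

  s<a₁ : s < a₁
  s<a₁ = <-trans s<k WS.k≤acc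

  a₁<a₂ : a₁ < a₂
  a₁<a₂ = <-trans WS.acc<fresh WT.k≤acc

  s<a₂ : s < a₂
  s<a₂ = <-trans s<a₁ a₁<a₂

  S-source : ∀ {x l z} → (x , l , z) ∈ t₁ → k ≤ x × x < k₁ × x ≢ a₁
  S-source m with WS.source-owned m
  ... | r , x≢a₁ = region-≥ (n≤1+n k) r , region-< k<k₁ r , x≢a₁

  T-source : ∀ {x l z} → (x , l , z) ∈ t₂ → k₁ ≤ x × x < k₂ × x ≢ a₂
  T-source m with WT.source-owned m
  ... | r , x≢a₂ = region-≥ (n≤1+n k₁) r , region-< k₁<k₂ r , x≢a₂

  inner-owned : k ≤ x → x < k₂ → Owned (S ∣ T) s k x
  inner-owned k≤x x<k₂ = inj₂ (k≤x , m<n⇒m<1+n x<k₂) , <⇒≢ x<k₂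

  S-part : Component S k (suc k) (S ∣ T) s k
  S-part = record
    { owned⊆ = λ (r , _) → inner-owned (region-≥ (n≤1+n k) r) (<-trans (region-< k<k₁ r) k₁<k₂)
    ; local  = local
    }
    where
    local : ∀ {x l z} → (x , l , z) ∈ edges (build (S ∣ T) s k) → Owned S k (suc k) x → (x , l , z) ∈ t₁
    local (here refl)                         (r , _) = ⊥-elim (<⇒≱ s<k (region-≥ (n≤1+n k) r))
    local (there (here refl))                 (r , _) = ⊥-elim (<⇒≱ s<k (region-≥ (n≤1+n k) r))
    local (there (there (here refl)))         (_ , x≢a₁) = ⊥-elim (x≢a₁ refl)
    local (there (there (there (here refl)))) (r , _) = ⊥-elim (<-asym (region-< k<k₁ r) WT.k≤acc)
    local (there (there (there (there m))))   (r , _) with ∈-++⁻ t₁ m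
    ... | inj₁ m₁ = m₁
    ... | inj₂ m₂ = ⊥-elim (<⇒≱ (region-< k<k₁ r) (proj₁ (T-source m₂)))

  T-part : Component T k₁ (suc k₁) (S ∣ T) s k
  T-part = record
    { owned⊆ = λ (r , _) → inner-owned (≤-trans (<⇒≤ k<k₁) (region-≥ (n≤1+n k₁) r)) (region-< k₁<k₂ r)
    ; local  = local
    }
    where
    local : ∀ {x l z} → (x , l , z) ∈ edges (build (S ∣ T) s k) → Owned T k₁ (suc k₁) x → (x , l , z) ∈ t₂
    local (here refl)                         (r , _) = ⊥-elim (<⇒≱ (<-trans s<k k<k₁) (region-≥ (n≤1+n k₁) r))
    local (there (here refl))                 (r , _) = ⊥-elim (<⇒≱ (<-trans s<k k<k₁) (region-≥ (n≤1+n k₁) r))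
    local (there (there (here refl)))         (r , _) = ⊥-elim (<⇒≱ WS.acc<fresh (region-≥ (n≤1+n k₁) r))
    local (there (there (there (here refl)))) (_ , x≢a₂) = ⊥-elim (x≢a₂ refl)
    local (there (there (there (there m))))   (r , _) with ∈-++⁻ t₁ m
    ... | inj₂ m₂ = m₂
    ... | inj₁ m₁ = ⊥-elim (<⇒≱ (proj₁ (proj₂ (S-source m₁))) (region-≥ (n≤1+n k₁) r))

  start-exits : ∀ {x l z} → (x , l , z) ∈ edges (build (S ∣ T) s k) → x ≡ s → l ≡ nothing × (z ≡ k ⊎ z ≡ k₁)
  start-exits (here refl)                         _ = refl , inj₁ refl
  start-exits (there (here refl))                 _ = refl , inj₂ refl
  start-exits (there (there (here refl)))         eq = ⊥-elim (<⇒≢ s<a₁ (≡-sym eq))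
  start-exits (there (there (there (here refl)))) eq = ⊥-elim (<⇒≢ s<a₂ (≡-sym eq))
  start-exits (there (there (there (there m))))   eq with ∈-++⁻ t₁ m
  ... | inj₁ m₁ = ⊥-elim (<⇒≱ s<k (subst (k ≤_) eq (proj₁ (S-source m₁))))
  ... | inj₂ m₂ = ⊥-elim (<⇒≱ (<-trans s<k k<k₁) (subst (k₁ ≤_) eq (proj₁ (T-source m₂))))

  accept₁-exits : ∀ {x l z} → (x , l , z) ∈ edges (build (S ∣ T) s k) → x ≡ a₁ → l ≡ nothing × z ≡ k₂
  accept₁-exits (here refl)                         eq = ⊥-elim (<⇒≢ s<a₁ eq)
  accept₁-exits (there (here refl))                 eq = ⊥-elim (<⇒≢ s<a₁ eq)
  accept₁-exits (there (there (here refl)))         _  = refl , refl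
  accept₁-exits (there (there (there (here refl)))) eq = ⊥-elim (<⇒≢ a₁<a₂ (≡-sym eq))
  accept₁-exits (there (there (there (there m))))   eq with ∈-++⁻ t₁ m
  ... | inj₁ m₁ = ⊥-elim (proj₂ (proj₂ (S-source m₁)) eq)
  ... | inj₂ m₂ = ⊥-elim (<⇒≱ WS.acc<fresh (subst (k₁ ≤_) eq (proj₁ (T-source m₂))))

  accept₂-exits : ∀ {x l z} → (x , l , z) ∈ edges (build (S ∣ T) s k) → x ≡ a₂ → l ≡ nothing × z ≡ k₂
  accept₂-exits (here refl)                         eq = ⊥-elim (<⇒≢ s<a₂ eq)
  accept₂-exits (there (here refl))                 eq = ⊥-elim (<⇒≢ s<a₂ eq)
  accept₂-exits (there (there (here refl)))         eq = ⊥-elim (<⇒≢ a₁<a₂ eq)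
  accept₂-exits (there (there (there (here refl)))) _  = refl , refl
  accept₂-exits (there (there (there (there m))))   eq with ∈-++⁻ t₁ m
  ... | inj₁ m₁ = ⊥-elim (<-asym (subst (_< k₁) eq (proj₁ (proj₂ (S-source m₁)))) WT.k≤acc)
  ... | inj₂ m₂ = ⊥-elim (proj₂ (proj₂ (T-source m₂)) eq)

  s-owned : Owned (S ∣ T) s k s
  s-owned = inj₁ refl , <⇒≢ (<-trans s<k (<-trans k<k₁ k₁<k₂))

  a₁-owned : Owned (S ∣ T) s k a₁
  a₁-owned = inner-owned (<⇒≤ WS.k≤acc) (<-trans WS.acc<fresh k₁<k₂)

  a₂-owned : Owned (S ∣ T) s k a₂
  a₂-owned = inner-owned (<⇒≤ (<-trans k<k₁ WT.k≤acc)) WT.acc<fresh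

  wf-∣ : WellFormed (S ∣ T) s k
  wf-∣ = wf (<⇒≤ (<-trans k<k₁ k₁<k₂)) ≤-refl source-owned
    where
    source-owned : ∀ {x l z} → (x , l , z) ∈ edges (build (S ∣ T) s k) → Owned (S ∣ T) s k x
    source-owned (here refl)                         = s-owned
    source-owned (there (here refl))                 = s-owned
    source-owned (there (there (here refl)))         = a₁-owned
    source-owned (there (there (there (here refl)))) = a₂-owned
    source-owned (there (there (there (there m))))   with ∈-++⁻ t₁ m
    ... | inj₁ m₁ = Component.owned⊆ S-part (WS.source-owned m₁)
    ... | inj₂ m₂ = Component.owned⊆ T-part (WT.source-owned m₂)

module StarParts (S : RE B) (s k : ℕ) (s<k : s < k) (wfS : WellFormed S k (suc k)) where
  module WS = WellFormed wfS

  a₁ = acc (build S k (suc k))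
  k₁ = fresh (build S k (suc k))
  t₁ = edges (build S k (suc k))

  k<k₁ : k < k₁
  k<k₁ = <-trans WS.k≤acc WS.acc<fresh

  inner-owned : k ≤ x → x < k₁ → Owned (S ⋆) s k x
  inner-owned k≤x x<k₁ = inj₂ (k≤x , m<n⇒m<1+n x<k₁) , <⇒≢ x<k₁

  body : Component S k (suc k) (S ⋆) s k
  body = record
    { owned⊆ = λ (r , _) → inner-owned (region-≥ (n≤1+n k) r) (region-< k<k₁ r)
    ; local  = local
    }
    where
    local : ∀ {x l z} → (x , l , z) ∈ edges (build (S ⋆) s k) → Owned S k (suc k) x → (x , l , z) ∈ t₁
    local (here refl)                         (r , _)    = ⊥-elim (<⇒≱ s<k (region-≥ (n≤1+n k) r))
    local (there (here refl))                 (r , _)    = ⊥-elim (<⇒≱ s<k (region-≥ (n≤1+n k) r))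
    local (there (there (here refl)))         (_ , x≢a₁) = ⊥-elim (x≢a₁ refl)
    local (there (there (there (here refl)))) (_ , x≢a₁) = ⊥-elim (x≢a₁ refl)
    local (there (there (there (there m))))   _          = m

  junction-exits : ∀ {x l z} → (x , l , z) ∈ edges (build (S ⋆) s k) → x ≡ s ⊎ x ≡ a₁ →
                   l ≡ nothing × (z ≡ k ⊎ z ≡ k₁)
  junction-exits (here refl)                         _ = refl , inj₁ refl
  junction-exits (there (here refl))                 _ = refl , inj₂ refl
  junction-exits (there (there (here refl)))         _ = refl , inj₁ refl
  junction-exits (there (there (there (here refl)))) _ = refl , inj₂ refl
  junction-exits (there (there (there (there m))))   (inj₁ refl) =
    ⊥-elim (<⇒≱ s<k (region-≥ (n≤1+n k) (proj₁ (WS.source-owned m))))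
  junction-exits (there (there (there (there m))))   (inj₂ refl) = ⊥-elim (proj₂ (WS.source-owned m) refl)

  s-owned : Owned (S ⋆) s k s
  s-owned = inj₁ refl , <⇒≢ (<-trans s<k k<k₁)

  a₁-owned : Owned (S ⋆) s k a₁
  a₁-owned = inner-owned (<⇒≤ WS.k≤acc) WS.acc<fresh

  wf-⋆ : WellFormed (S ⋆) s k
  wf-⋆ = wf (<⇒≤ k<k₁) ≤-refl source-owned
    where
    source-owned : ∀ {x l z} → (x , l , z) ∈ edges (build (S ⋆) s k) → Owned (S ⋆) s k x
    source-owned (here refl)                         = s-owned
    source-owned (there (here refl))                 = s-owned
    source-owned (there (there (here refl)))         = a₁-owned
    source-owned (there (there (there (here refl)))) = a₁-owned
    source-owned (there (there (there (there m))))   = Component.owned⊆ body (WS.source-owned m)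

build-wf : (e : RE B) (s k : ℕ) → s < k → WellFormed e s k
build-wf (chr c) s k s<k = wf ≤-refl ≤-refl λ { (here refl) → inj₁ refl , <⇒≢ s<k }
build-wf eps     s k s<k = wf ≤-refl ≤-refl λ { (here refl) → inj₁ refl , <⇒≢ s<k }
build-wf (S · T) s k s<k = CatParts.wf-· S T s k s<k wfS (build-wf T _ _ (WellFormed.acc<fresh wfS))
  where wfS = build-wf S s k s<k
build-wf (S ∣ T) s k s<k = AltParts.wf-∣ S T s k s<k wfS (build-wf T _ _ ≤-refl)
  where wfS = build-wf S k (suc k) ≤-refl
build-wf (S ⋆)   s k s<k = StarParts.wf-⋆ S s k s<k (build-wf S k (suc k) ≤-refl)

module Cat {B : Set} (S T : RE B) (s k : ℕ) (s<k : s < k) =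
  CatParts S T s k s<k (build-wf S s k s<k) (build-wf T _ _ (WellFormed.acc<fresh (build-wf S s k s<k)))
module Alt {B : Set} (S T : RE B) (s k : ℕ) (s<k : s < k) =
  AltParts S T s k s<k (build-wf S k (suc k) ≤-refl) (build-wf T _ _ ≤-refl)
module Star {B : Set} (S : RE B) (s k : ℕ) (s<k : s < k) =
  StarParts S s k s<k (build-wf S k (suc k) ≤-refl)

Edges : Set → Set
Edges B = List (ℕ × Maybe B × ℕ)

NoBetaEdge : Edges (Sym A) → Set
NoBetaEdge t = ∀ {x z} → (x , just β , z) ∈ t → ⊥

β-edge-left : {t₁ t₂ : Edges (Sym A)} → NoBetaEdge t₂ →
              (x , just β , z) ∈ t₁ ++ t₂ → (x , just β , z) ∈ t₁
β-edge-left {t₁ = t₁} none m with ∈-++⁻ t₁ m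
... | inj₁ m₁ = m₁
... | inj₂ m₂ = ⊥-elim (none m₂)

β-edge-right : {t₁ t₂ : Edges (Sym A)} → NoBetaEdge t₁ →
               (x , just β , z) ∈ t₁ ++ t₂ → (x , just β , z) ∈ t₂
β-edge-right {t₁ = t₁} none m with ∈-++⁻ t₁ m
... | inj₁ m₁ = ⊥-elim (none m₁)
... | inj₂ m₂ = m₂

betaFree-edges : (e : RE (Sym A)) → BetaFree e → ∀ s k → NoBetaEdge (edges (build e s k))
betaFree-edges (chr (sym _)) _ s k (here ())
betaFree-edges eps _ s k (here ())
betaFree-edges (S · T) (fS , fT) s k m =
  [ betaFree-edges S fS s k , betaFree-edges T fT _ _ ]′ (∈-++⁻ (edges (build S s k)) m)
betaFree-edges (S ∣ T) (fS , fT) s k (there (there (there (there m)))) =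
  [ betaFree-edges S fS _ _ , betaFree-edges T fT _ _ ]′ (∈-++⁻ (edges (build S k (suc k))) m)
betaFree-edges (S ⋆) fS s k (there (there (there (there m)))) = betaFree-edges S fS _ _ m

singleBeta-edge : (e : RE (Sym A)) → SingleBeta e → ∀ s k {x z x′ z′} →
                  (x , just β , z) ∈ edges (build e s k) → (x′ , just β , z′) ∈ edges (build e s k) →
                  x ≡ x′ × z ≡ z′
singleBeta-edge (chr β) _ s k (here refl) (here refl) = refl , refl
singleBeta-edge (S · T) (inj₁ (oS , fT)) s k m m′ =
  singleBeta-edge S oS s k (β-edge-left none m) (β-edge-left none m′)
  where none = betaFree-edges T fT _ _
singleBeta-edge (S · T) (inj₂ (fS , oT)) s k m m′ =
  singleBeta-edge T oT _ _ (β-edge-right none m) (β-edge-right none m′)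
  where none = betaFree-edges S fS s k
singleBeta-edge (S ∣ T) (inj₁ (oS , fT)) s k (there (there (there (there m)))) (there (there (there (there m′)))) =
  singleBeta-edge S oS _ _ (β-edge-left none m) (β-edge-left none m′)
  where none = betaFree-edges T fT _ _
singleBeta-edge (S ∣ T) (inj₂ (fS , oT)) s k (there (there (there (there m)))) (there (there (there (there m′)))) =
  singleBeta-edge T oT _ _ (β-edge-right none m) (β-edge-right none m′)
  where none = betaFree-edges S fS _ _
singleBeta-edge (S ⋆) oS s k (there (there (there (there m)))) (there (there (there (there m′)))) =
  singleBeta-edge S oS _ _ m m′

-- Paths of an automaton over Σ ∪ {β} on which a β-edge reads any word of P.
module Walks {A : Set} (P : List A → Set) where
  open Semantics P

  data Walk (T : Edges (Sym A)) : ℕ → List A → ℕ → Set where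
    here : ∀ {x} → Walk T x [] x
    step : ∀ {x l x′ u w y} → (x , l , x′) ∈ T → Consumes l u → Walk T x′ w y → Walk T x (u ++ w) y

  private
    variable
      T T′ : Edges (Sym A)
      u v w : List A
      x′ : ℕ
      Pre Pre′ : List A → Set

  steps : Walk T x w y → ℕ
  steps here           = 0
  steps (step _ _ r) = suc (steps r)

  walk-mono : (∀ {t} → t ∈ T → t ∈ T′) → Walk T x w y → Walk T′ x w y
  walk-mono f here           = here
  walk-mono f (step m c r) = step (f m) c (walk-mono f r)

  _++ʷ_ : Walk T x u y → Walk T y v z → Walk T x (u ++ v) z
  here ++ʷ r′ = r′
  _++ʷ_ {v = v} (step {u = u} {w = w} m c r) r′ =
    subst (λ q → Walk _ _ q _) (≡-sym (++-assoc u w v)) (step m c (r ++ʷ r′))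

  edge-walk : ∀ {l} → (x , l , y) ∈ T → Consumes l u → Walk T x u y
  edge-walk {u = u} m c = subst (λ q → Walk _ _ q _) (++-identityʳ u) (step m c here)

  _▹_ : Walk T x w y → (y , nothing , z) ∈ T → Walk T x w z
  _▹_ {w = w} r m = subst (λ q → Walk _ _ q _) (++-identityʳ w) (r ++ʷ edge-walk m refl)

  build-complete : (e : RE (Sym A)) (s k : ℕ) → ⟦ e ⟧ w → Walk (edges (build e s k)) s w (acc (build e s k))
  build-complete (chr c) s k p = edge-walk (here refl) p
  build-complete eps     s k p = edge-walk (here refl) p
  build-complete (S · T) s k (u , v , refl , pu , pv) =
    walk-mono ∈-++⁺ˡ (build-complete S s k pu) ++ʷ walk-mono (∈-++⁺ʳ _) (build-complete T _ _ pv)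
  build-complete (S ∣ T) s k (inj₁ pu) =
    step (here refl) refl
      (walk-mono (there ∘ there ∘ there ∘ there ∘ ∈-++⁺ˡ) (build-complete S k (suc k) pu) ▹ there (there (here refl)))
  build-complete (S ∣ T) s k (inj₂ pv) =
    step (there (here refl)) refl
      (walk-mono (there ∘ there ∘ there ∘ there ∘ ∈-++⁺ʳ _) (build-complete T _ _ pv) ▹ there (there (there (here refl))))
  build-complete (S ⋆) s k nil = step (there (here refl)) refl here
  build-complete (S ⋆) s k (cons pu ps) = step (here refl) refl (body pu ++ʷ loop ps)
    where
    body : ⟦ S ⟧ u → Walk (edges (build (S ⋆) s k)) k u (acc (build S k (suc k)))
    body pu = walk-mono (there ∘ there ∘ there ∘ there) (build-complete S k (suc k) pu)
    loop : StarL ⟦ S ⟧ w → Walk (edges (build (S ⋆) s k)) (acc (build S k (suc k))) w (fresh (build S k (suc k)))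
    loop nil          = edge-walk (there (there (there (here refl)))) refl
    loop (cons pu ps) = step (there (there (here refl))) refl (body pu ++ʷ loop ps)

  record Prefix {T : Edges (Sym A)} (Pre : List A → Set) (z : ℕ) {x w y} (r : Walk T x w y) : Set where
    constructor prefix
    field
      head tail : List A
      split     : w ≡ head ++ tail
      head∈     : Pre head
      rest      : Walk T z tail y
      rest≤     : steps rest ≤ steps r

  prefix-weaken : {r : Walk T x w y} {r′ : Walk T x′ w y} → steps r ≤ steps r′ → Prefix Pre z r → Prefix Pre z r′
  prefix-weaken r≤r′ (prefix u v eq pu rest le) = prefix u v eq pu rest (≤-trans le r≤r′)

  prefix-map : {r : Walk T x w y} → Pre ⊆ Pre′ → Prefix Pre z r → Prefix Pre′ z r
  prefix-map f (prefix u v eq pu rest le) = prefix u v eq (f pu) rest le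

  Governs : RE (Sym A) → ℕ → ℕ → Edges (Sym A) → Set
  Governs e s k T = ∀ {x l z} → (x , l , z) ∈ T → Owned e s k x → (x , l , z) ∈ edges (build e s k)

  governs-part : {e o : RE (Sym A)} → Component e s k o s′ k′ → Governs o s′ k′ T → Governs e s k T
  governs-part c g m d = Component.local c (g m (Component.owned⊆ c d)) d

  -- Soundness of build e s k inside any automaton adding no edges out of its states: a walk
  -- from s that ends outside them passes through the accept state after reading a word of ⟦ e ⟧.
  -- The bound on the remaining walk is what lets the star case iterate.
  Sound : RE (Sym A) → ℕ → ℕ → Set
  Sound e s k = ∀ {T} → Governs e s k T → ∀ {w y} (r : Walk T s w y) → ¬ Owned e s k y →
                Prefix ⟦ e ⟧ (acc (build e s k)) r

  AlwaysSound : RE (Sym A) → Set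
  AlwaysSound e = ∀ {s k} → s < k → Sound e s k

  ε-exit : {N : ℕ → Set} → (∀ {l z} → (x , l , z) ∈ T → l ≡ nothing × N z) → x ≢ y →
           (r : Walk T x w y) → ∃ λ z → N z × Σ (Walk T z w y) λ r′ → steps r′ < steps r
  ε-exit f x≢y here = ⊥-elim (x≢y refl)
  ε-exit f x≢y (step m c r) with f m
  ε-exit f x≢y (step m refl r) | refl , nz = _ , nz , r , ≤-refl

  module _ (S T : RE (Sym A)) (s k : ℕ) (s<k : s < k) where
    open Cat S T s k s<k
    open Component

    sound-· : Sound S s k → AlwaysSound T → Sound (S · T) s k
    sound-· IHS IHT g r ¬y with IHS (governs-part S-part g) r (¬y ∘ owned⊆ S-part)
    ... | prefix u w₁ refl pu r₁ le₁ with IHT WS.acc<fresh (governs-part T-part g) r₁ (¬y ∘ owned⊆ T-part)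
    ... | prefix v w₂ refl pv r₂ le₂ =
      prefix (u ++ v) w₂ (≡-sym (++-assoc u v w₂)) (u , v , refl , pu , pv) r₂ (≤-trans le₂ le₁)

  module _ (S T : RE (Sym A)) (s k : ℕ) (s<k : s < k) where
    open Alt S T s k s<k
    open Component

    alt-branch : {X : RE (Sym A)} {s′ : ℕ} → Governs (S ∣ T) s k T′ → ¬ Owned (S ∣ T) s k y →
                 Component X s′ (suc s′) (S ∣ T) s k → Sound X s′ (suc s′) →
                 (∀ {x l z} → (x , l , z) ∈ edges (build (S ∣ T) s k) → x ≡ acc (build X s′ (suc s′)) →
                   l ≡ nothing × z ≡ k₂) →
                 Owned (S ∣ T) s k (acc (build X s′ (suc s′))) →
                 (r : Walk T′ s′ w y) → Prefix ⟦ X ⟧ k₂ r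
    alt-branch g ¬y part IH exits a-owned r with IH (governs-part part g) r (¬y ∘ owned⊆ part)
    ... | prefix u v refl pu r₁ le₁ with ε-exit (λ m → exits (g m a-owned) refl) (λ { refl → ¬y a-owned }) r₁
    ... | _ , refl , r₂ , lt₂ = prefix u v refl pu r₂ (≤-trans (<⇒≤ lt₂) le₁)

    sound-∣ : AlwaysSound S → AlwaysSound T → Sound (S ∣ T) s k
    sound-∣ IHS IHT g r ¬y with ε-exit (λ m → start-exits (g m s-owned) refl) (λ { refl → ¬y s-owned }) r
    ... | _ , inj₁ refl , r₁ , lt =
      prefix-weaken (<⇒≤ lt) (prefix-map inj₁ (alt-branch g ¬y S-part (IHS ≤-refl) accept₁-exits a₁-owned r₁))
    ... | _ , inj₂ refl , r₁ , lt =
      prefix-weaken (<⇒≤ lt) (prefix-map inj₂ (alt-branch g ¬y T-part (IHT ≤-refl) accept₂-exits a₂-owned r₁))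

  module _ (S : RE (Sym A)) (s k : ℕ) (s<k : s < k) where
    open Star S s k s<k
    open Component

    star-iterations : AlwaysSound S → Governs (S ⋆) s k T′ → ¬ Owned (S ⋆) s k y →
                      (r : Walk T′ k w y) → Acc _<_ (steps r) → Prefix (StarL ⟦ S ⟧) k₁ r
    star-iterations IHS g ¬y r (Acc.acc rs) with IHS ≤-refl (governs-part body g) r (¬y ∘ owned⊆ body)
    ... | prefix u v refl pu r₁ le₁
      with ε-exit (λ m → junction-exits (g m a₁-owned) (inj₂ refl)) (λ { refl → ¬y a₁-owned }) r₁
    ...   | _ , inj₂ refl , r₂ , lt₂ =
      prefix (u ++ []) v (cong (_++ v) (≡-sym (++-identityʳ u))) (cons pu nil) r₂ (<⇒≤ (<-≤-trans lt₂ le₁))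
    ...   | _ , inj₁ refl , r₂ , lt₂ with star-iterations IHS g ¬y r₂ (rs (<-≤-trans lt₂ le₁))
    ...     | prefix u′ v′ refl pu′ r₃ le₃ =
      prefix (u ++ u′) v′ (≡-sym (++-assoc u u′ v′)) (cons pu pu′) r₃ (≤-trans le₃ (<⇒≤ (<-≤-trans lt₂ le₁)))

    sound-⋆ : AlwaysSound S → Sound (S ⋆) s k
    sound-⋆ IHS g r ¬y with ε-exit (λ m → junction-exits (g m s-owned) (inj₁ refl)) (λ { refl → ¬y s-owned }) r
    ... | _ , inj₂ refl , r₁ , lt = prefix [] _ refl nil r₁ (<⇒≤ lt)
    ... | _ , inj₁ refl , r₁ , lt = prefix-weaken (<⇒≤ lt) (star-iterations IHS g ¬y r₁ (<-wellFounded (steps r₁)))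

  sound : (e : RE (Sym A)) (s k : ℕ) → s < k → Sound e s k
  sound e s k s<k g here ¬y = ⊥-elim (¬y (start-owned (build-wf e s k s<k) s<k))
  sound (chr c) s k s<k g (step m pu r) ¬y with g m (inj₁ refl , <⇒≢ s<k)
  ... | here refl = prefix _ _ refl pu r (n≤1+n _)
  sound eps s k s<k g (step m pu r) ¬y with g m (inj₁ refl , <⇒≢ s<k)
  ... | here refl = prefix _ _ refl pu r (n≤1+n _)
  sound (S · T) s k s<k g r ¬y = sound-· S T s k s<k (sound S s k s<k) (sound T _ _) g r ¬y
  sound (S ∣ T) s k s<k g r ¬y = sound-∣ S T s k s<k (sound S _ _) (sound T _ _) g r ¬y
  sound (S ⋆)   s k s<k g r ¬y = sound-⋆ S s k s<k (sound S _ _) g r ¬y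

  thompson-sound : (e : RE (Sym A)) → Walk (edges (build e 0 1)) 0 w (acc (build e 0 1)) → ⟦ e ⟧ w
  thompson-sound e r with sound e 0 1 z<s (λ m _ → m) r (λ (_ , a≢a) → a≢a refl)
  ... | prefix u v refl pu r′ _ = subst ⟦ e ⟧ (≡-sym (≡-trans (cong (u ++_) (stuck r′)) (++-identityʳ u))) pu
    where
    -- the accept state has no outgoing edges
    stuck : Walk (edges (build e 0 1)) (acc (build e 0 1)) v y → v ≡ []
    stuck here           = refl
    stuck (step m _ _) = ⊥-elim (proj₂ (WellFormed.source-owned (build-wf e 0 1 z<s) m) refl)

  thompson-correct : (e : RE (Sym A)) →
                     ⟦ e ⟧ ≋ λ w → Walk (trans (thompson e)) (start (thompson e)) w (accept (thompson e))
  thompson-correct e = build-complete e 0 1 , thompson-sound e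

take-+ : ∀ m n (xs : List A) → take m xs ++ take n (drop m xs) ≡ take (m + n) xs
take-+ zero    n xs       = refl
take-+ (suc m) n []       = take-[] n
take-+ (suc m) n (x ∷ xs) = cong (x ∷_) (take-+ m n xs)

slice-+ : ∀ (Q : List A) i d₁ d₂ →
          slice Q i (i + d₁) ++ slice Q (i + d₁) (i + d₁ + d₂) ≡ slice Q i (i + d₁ + d₂)
slice-+ Q i d₁ d₂ = begin
  take (i + d₁ ∸ i) X ++ take (i + d₁ + d₂ ∸ (i + d₁)) (drop (i + d₁) Q)
    ≡⟨ cong₂ (λ a b → take a X ++ take b (drop (i + d₁) Q)) (m+n∸m≡n i d₁) (m+n∸m≡n (i + d₁) d₂) ⟩
  take d₁ X ++ take d₂ (drop (i + d₁) Q)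
    ≡⟨ cong (λ ys → take d₁ X ++ take d₂ ys) (drop-drop i d₁ Q) ⟨
  take d₁ X ++ take d₂ (drop d₁ X)
    ≡⟨ take-+ d₁ d₂ X ⟩
  take (d₁ + d₂) X
    ≡⟨ cong (λ n → take n X) (≡-trans (cong (_∸ i) (+-assoc i d₁ d₂)) (m+n∸m≡n i (d₁ + d₂))) ⟨
  take (i + d₁ + d₂ ∸ i) X ∎
  where
  open ≡-Reasoning
  X = drop i Q

slice-++ : ∀ (Q : List A) {i l j} → i ≤ l → l ≤ j → slice Q i l ++ slice Q l j ≡ slice Q i j
slice-++ Q {i} i≤l l≤j with m≤n⇒∃[o]m+o≡n i≤l
... | d₁ , refl with m≤n⇒∃[o]m+o≡n l≤j
... | d₂ , refl = slice-+ Q i d₁ d₂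

slice-empty : ∀ (Q : List A) i → slice Q i i ≡ []
slice-empty Q i rewrite n∸n≡0 i = refl

length-slice : ∀ (Q : List A) i j → j ≤ length Q → length (slice Q i j) ≡ j ∸ i
length-slice Q i j j≤∣Q∣ = begin
  length (take (j ∸ i) (drop i Q)) ≡⟨ length-take (j ∸ i) (drop i Q) ⟩
  (j ∸ i) ⊓ length (drop i Q)      ≡⟨ cong ((j ∸ i) ⊓_) (length-drop i Q) ⟩
  (j ∸ i) ⊓ (length Q ∸ i)         ≡⟨ m≤n⇒m⊓n≡m (∸-monoˡ-≤ i j≤∣Q∣) ⟩
  j ∸ i                            ∎
  where open ≡-Reasoning

++-cancel-length : ∀ (xs ys us vs : List A) → length xs ≡ length us → xs ++ ys ≡ us ++ vs → xs ≡ us × ys ≡ vs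
++-cancel-length []       ys []       vs _   eq = refl , eq
++-cancel-length (x ∷ xs) ys (u ∷ us) vs len eq with ∷-injective eq
... | refl , eq′ with ++-cancel-length xs ys us vs (suc-injective len) eq′
... | refl , refl = refl , refl

slice-split : ∀ (Q : List A) i j u w → i ≤ j → j ≤ length Q → slice Q i j ≡ u ++ w →
              i + length u ≤ j × slice Q i (i + length u) ≡ u × slice Q (i + length u) j ≡ w
slice-split Q i j u w i≤j j≤∣Q∣ eq =
  l≤j , ++-cancel-length _ _ u w length-first (≡-trans (slice-++ Q (m≤m+n i _) l≤j) eq)
  where
  l = i + length u
  ∣u∣≤j∸i : length u ≤ j ∸ i
  ∣u∣≤j∸i = begin
    length u              ≤⟨ m≤m+n (length u) (length w) ⟩
    length u + length w   ≡⟨ length-++ u ⟨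
    length (u ++ w)       ≡⟨ cong length eq ⟨
    length (slice Q i j)  ≡⟨ length-slice Q i j j≤∣Q∣ ⟩
    j ∸ i                 ∎
    where open ≤-Reasoning
  l≤j : l ≤ j
  l≤j = ≤-trans (+-monoʳ-≤ i ∣u∣≤j∸i) (≤-reflexive (m+[n∸m]≡n i≤j))
  length-first : length (slice Q i l) ≡ length u
  length-first = ≡-trans (length-slice Q i l (≤-trans l≤j j≤∣Q∣)) (m+n∸m≡n i (length u))

module MatchGraphs {A : Set} (Q : List A) (Rp : ERE A) (M : NFA (Sym A)) (θ′ φ′ : ℕ)
                   (β-edge : (θ′ , just β , φ′) ∈ trans M)
                   (β-unique : ∀ {x z} → (x , just β , z) ∈ trans M → x ≡ θ′ × z ≡ φ′) where
  open Semantics (Lang Rp)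
  open Walks (Lang Rp)

  V = Fin (suc (length Q))

  private
    variable
      i j l m : V
      u w : List A

  sl : V → V → List A
  sl i j = slice Q (toℕ i) (toℕ j)

  -- G(M, x, y) for the automaton in which the β-edge is replaced by an automaton for R(p).
  WG : ℕ → ℕ → Graph (length Q)
  WG x y i j = toℕ i ≤ toℕ j × Walk (trans M) x (sl i j) y

  WG-refl : WG x x i i
  WG-refl {i = i} = ≤-refl , subst (λ q → Walk _ _ q _) (≡-sym (slice-empty Q (toℕ i))) here

  WG-trans : WG x y i l → WG y z l j → WG x z i j
  WG-trans (i≤l , r) (l≤j , r′) = ≤-trans i≤l l≤j , subst (λ q → Walk _ _ q _) (slice-++ Q i≤l l≤j) (r ++ʷ r′)

  run⇒walk : Run M x w y → Walk (trans M) x w y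
  run⇒walk here          = here
  run⇒walk (εstep m r) = step m refl (run⇒walk r)
  run⇒walk (cstep m r) = step m refl (run⇒walk r)

  NG⊆WG : NG Q M x y i j → WG x y i j
  NG⊆WG (i≤j , r) = i≤j , run⇒walk r

  MG⊆WG : MG Q Rp i j → WG θ′ φ′ i j
  MG⊆WG (i≤j , p) = i≤j , edge-walk β-edge p

  Loop : Graph (length Q)
  Loop = NG Q M φ′ θ′ ⊙ MG Q Rp

  Formula : ℕ → ℕ → Graph (length Q)
  Formula x y = NG Q M x y ∣G (NG Q M x θ′ ⊙ MG Q Rp ⊙ Loop * ⊙ NG Q M φ′ y)

  loops⊆WG : (Loop *) i j → WG φ′ φ′ i j
  loops⊆WG ε                  = WG-refl
  loops⊆WG ((_ , n , p) ◅ ls) = WG-trans (NG⊆WG n) (WG-trans (MG⊆WG p) (loops⊆WG ls))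

  formula⊆WG : Formula x y i j → WG x y i j
  formula⊆WG (inj₁ n) = NG⊆WG n
  formula⊆WG (inj₂ (_ , n , _ , p , _ , ls , n′)) =
    WG-trans (NG⊆WG n) (WG-trans (MG⊆WG p) (WG-trans (loops⊆WG ls) (NG⊆WG n′)))

  split-at : toℕ i ≤ toℕ j → sl i j ≡ u ++ w →
             ∃ λ l → toℕ i ≤ toℕ l × toℕ l ≤ toℕ j × sl i l ≡ u × sl l j ≡ w
  split-at {i = i} {j = j} {u = u} {w = w} i≤j eq
    with slice-split Q (toℕ i) (toℕ j) u w i≤j (toℕ≤pred[n] j) eq
  ... | c≤j , first , second = cut , subst (toℕ i ≤_) toℕ-cut (m≤m+n _ _) , subst (_≤ toℕ j) toℕ-cut c≤j ,
                               subst (λ q → slice Q (toℕ i) q ≡ u) toℕ-cut first ,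
                               subst (λ q → slice Q q (toℕ j) ≡ w) toℕ-cut second
    where
    cut : V
    cut = fromℕ< (s≤s (≤-trans c≤j (toℕ≤pred[n] j)))
    toℕ-cut : toℕ i + length u ≡ toℕ cut
    toℕ-cut = ≡-sym (toℕ-fromℕ< _)

  run-++ : Run M x u y → Run M y w z → Run M x (u ++ w) z
  run-++ here        r′ = r′
  run-++ (εstep m r) r′ = εstep m (run-++ r r′)
  run-++ (cstep m r) r′ = cstep m (run-++ r r′)

  NG-trans : NG Q M x y i l → NG Q M y z l j → NG Q M x z i j
  NG-trans (i≤l , r) (l≤j , r′) = ≤-trans i≤l l≤j , subst (λ q → Run M _ q _) (slice-++ Q i≤l l≤j) (run-++ r r′)

  prepend : NG Q M x y i l → Formula y z l j → Formula x z i j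
  prepend n (inj₁ n′)            = inj₁ (NG-trans n n′)
  prepend n (inj₂ (l , n′ , rest)) = inj₂ (l , NG-trans n n′ , rest)

  loop-rest : Formula φ′ y i j → (Loop * ⊙ NG Q M φ′ y) i j
  loop-rest {i = i} (inj₁ n)                            = i , ε , n
  loop-rest (inj₂ (l₁ , n , l₂ , p , l₃ , ls , n′)) = l₃ , (l₁ , n , p) ◅ ls , n′

  NG-refl : NG Q M x x i i
  NG-refl {i = i} = ≤-refl , subst (λ q → Run M _ q _) (≡-sym (slice-empty Q (toℕ i))) here

  -- A β-edge can only be θ′ → φ′, so it opens the first R(p)-block of the formula.
  formula-step : ∀ {x′ lab} → (x , lab , x′) ∈ trans M → Consumes lab u → toℕ i ≤ toℕ m → sl i m ≡ u →
                 Formula x′ y m j → Formula x y i j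
  formula-step {lab = nothing} e refl i≤m first f =
    prepend (i≤m , subst (λ q → Run M _ q _) (≡-sym first) (εstep e here)) f
  formula-step {lab = just (sym a)} e refl i≤m first f =
    prepend (i≤m , subst (λ q → Run M _ q _) (≡-sym first) (cstep e here)) f
  formula-step {i = i} {m = m} {lab = just β} e p i≤m first f with β-unique e
  ... | refl , refl = inj₂ (i , NG-refl , m , (i≤m , subst (Lang Rp) (≡-sym first) p) , loop-rest f)

  walk⊆formula : Walk (trans M) x w y → toℕ i ≤ toℕ j → sl i j ≡ w → Formula x y i j
  walk⊆formula here i≤j eq = inj₁ (i≤j , subst (λ q → Run M _ q _) (≡-sym eq) here)
  walk⊆formula (step e c r) i≤j eq with split-at i≤j eq
  ... | _ , i≤m , m≤j , first , second = formula-step e c i≤m first (walk⊆formula r m≤j second)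

  β-decomposition : Formula x y ≐ WG x y
  β-decomposition i j = formula⊆WG , λ (i≤j , r) → walk⊆formula r i≤j refl

≐-trans : {n : ℕ} {G H K : Graph n} → G ≐ H → H ≐ K → G ≐ K
≐-trans G≐H H≐K i j = proj₁ (H≐K i j) ∘ proj₁ (G≐H i j) , proj₂ (G≐H i j) ∘ proj₂ (H≐K i j)

-- Only the fact that A_C is the Thompson automaton of R(v) with the subtree at p cut out as β
-- is used; the cluster hypotheses merely describe where this situation arises.
lemma4 : {A : Set} (R : ERE A) (Q : List A) (v p p' : Pos) (Rv Rp : ERE A)
         (E : RE (Sym A)) (θ' φ' : ℕ) →
         ClusterRoot R v → Internal R v → MoreThanOneNode R v →
         InCluster R v p → ExtNode R p →
         subAt R v ≡ just Rv → subAt R p ≡ just Rp →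
         p ≡ v ++ p' → hole Rv p' ≡ just E →
         (θ' , just β , φ') ∈ trans (thompson E) →
         (NG Q (thompson E) (start (thompson E)) (accept (thompson E))
           ∣G (NG Q (thompson E) (start (thompson E)) θ' ⊙ MG Q Rp
               ⊙ (NG Q (thompson E) φ' θ' ⊙ MG Q Rp) *
               ⊙ NG Q (thompson E) φ' (accept (thompson E))))
         ≐ MG Q Rv
lemma4 R Q v p p' Rv Rp E θ' φ' _ _ _ _ _ Rv-at-v Rp-at-p refl E-hole β-edge =
  ≐-trans β-decomposition accepting-walks
  where
  Rp-in-Rv : subAt Rv p' ≡ just Rp
  Rp-in-Rv = ≡-trans (≡-sym (subAt-++ R v p' Rv-at-v)) Rp-at-p
  single = proj₁ (hole-correct Rv p' E-hole Rp-in-Rv)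
  Rv≋E   = proj₂ (hole-correct Rv p' E-hole Rp-in-Rv)
  open MatchGraphs Q Rp (thompson E) θ' φ' β-edge (λ e → singleBeta-edge E single 0 1 e β-edge)
  open Walks (Lang Rp) using (thompson-correct)
  accepting-walks : WG (start (thompson E)) (accept (thompson E)) ≐ MG Q Rv
  accepting-walks i j = (λ (i≤j , r) → i≤j , proj₂ Rv≋E (proj₂ (thompson-correct E) r))
                      , (λ (i≤j , w∈Rv) → i≤j , proj₁ (thompson-correct E) (proj₁ Rv≋E w∈Rv))
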